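{- Let $A,B,C$ be sets. For all $\tau\in I_{BC}$ and $\sigma\in I_{AB}$ we have $\mathsf{reflect}(\mathsf{comp}(\tau,\sigma))=\mathsf{reflect}(\tau)\circ\mathsf{reflect}(\sigma)$ as functions $A^{\mathbb{N}}\to C^{\mathbb{N}}$; that is, $\mathsf{reflect}\circ\mathsf{comp}=(\circ)\circ(\mathsf{reflect}\times\mathsf{reflect})\colon I_{BC}\times I_{AB}\to\mathbf{Top}(A^{\mathbb{N}},C^{\mathbb{N}})$.
   Context: For a set $X$, $T_X(V)$ is the set of well-founded $X$-ary branching trees with leaves labelled in $V$ (a leaf $v$, or $\mathsf{read}(\lambda x.\,t_x)$ with $t\in T_X(V)^X$); $t(w)$ denotes substitution of trees $w(v)$ for leaves $v$. For sets $X,Y$, $\theta_{XY}\colon I_{XY}\to T_X(Y\times I_{XY})$ is a final coalgebra for $T_X(Y\times-)$ (the intensional $X$-$Y$-stream processors). $A^{\mathbb{N}}$ etc. carry the product of discrete topologies; $\partial$ is the shift on streams. For $t\in T_X(V)$ define $\langle t\rangle\colon X^{\mathbb{N}}\to V\times X^{\mathbb{N}}$ by $\langle v\rangle(\vec x)=(v,\vec x)$ and $\langle\mathsf{read}(\lambda x.\,t_x)\rangle(\vec x)=\langle t_{x_0}\rangle(\partial\vec x)$. For $\sigma\in I_{XY}$ write $\langle\theta_{XY}(\sigma)\rangle(\vec x)=(\mathsf{hd}(\sigma,\vec x),\mathsf{next}(\sigma,\vec x),\mathsf{tl}(\sigma,\vec x))$; then $\mathsf{reflect}(\sigma)\colon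 X^{\mathbb{N}}\to Y^{\mathbb{N}}$ is defined coinductively by $(\mathsf{reflect}(\sigma)(\vec x))_0=\mathsf{hd}(\sigma,\vec x)$ and $\partial(\mathsf{reflect}(\sigma)(\vec x))=\mathsf{reflect}(\mathsf{next}(\sigma,\vec x))(\mathsf{tl}(\sigma,\vec x))$ (this function is continuous). The lazy composition $\mathsf{comp}\colon I_{BC}\times I_{AB}\to I_{AC}$ is the unique $T_A(C\times-)$-coalgebra map from the coalgebra on $I_{BC}\times I_{AB}$ with structure $(\tau,\sigma)\mapsto[\![\theta_{BC}(\tau)]\!](\sigma)$ to $(I_{AC},\theta_{AC})$, where for $t\in T_B(V)$, $[\![t]\!]\colon I_{AB}\to T_A(V\times I_{AB})$ is given by $[\![v]\!](\sigma)=(v,\sigma)$ and $[\![\mathsf{read}(\lambda b.\,t_b)]\!](\sigma)=\theta_{AB}(\sigma)(\lambda(b,\sigma').\,[\![t_b]\!](\sigma'))$. -}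

module Defs where

open import Data.Nat using (ℕ; zero; suc)
open import Data.Product using (_×_; _,_; proj₁; proj₂; map₂)
open import Relation.Binary.PropositionalEquality using (_≡_)

data Tree (X : Set) (V : Set) : Set where
  leaf : V → Tree X V
  read : (X → Tree X V) → Tree X V

mapT : {X V W : Set} → (V → W) → Tree X V → Tree X W
mapT g (leaf v) = leaf (g v)
mapT g (read t) = read (λ x → mapT g (t x))

substT : {X V W : Set} → Tree X V → (V → Tree X W) → Tree X W
substT (leaf v) w = w v
substT (read t) w = read (λ x → substT (t x) w)

Str : Set → Set
Str X = ℕ → X

∂ : {X : Set} → Str X → Str X
∂ xs n = xs (suc n)

run : {X V : Set} → Tree X V → Str X → V × Str X
run (leaf v) xs = v , xs
run (read t) xs = run (t (xs 0)) (∂ xs)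

record FinalCoalg (X Y : Set) : Set₁ where
  field
    I : Set
    θ : I → Tree X (Y × I)
    unfold : {S : Set} → (S → Tree X (Y × S)) → S → I
    unfold-hom : {S : Set} (γ : S → Tree X (Y × S)) (s : S) →
                 θ (unfold γ s) ≡ mapT (map₂ (unfold γ)) (γ s)
    unfold-unique : {S : Set} (γ : S → Tree X (Y × S)) (f : S → I) →
                    ((s : S) → θ (f s) ≡ mapT (map₂ f) (γ s)) →
                    (s : S) → f s ≡ unfold γ s

module _ {X Y : Set} (F : FinalCoalg X Y) where
  open FinalCoalg F

  hd : I → Str X → Y
  hd σ xs = proj₁ (proj₁ (run (θ σ) xs))

  next : I → Str X → I
  next σ xs = proj₂ (proj₁ (run (θ σ) xs))

  tl : I → Str X → Str X
  tl σ xs = proj₂ (run (θ σ) xs)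

  reflect : I → Str X → Str Y
  reflect σ xs zero = hd σ xs
  reflect σ xs (suc n) = reflect (next σ xs) (tl σ xs) n

module _ {A B : Set} (FAB : FinalCoalg A B) where
  open FinalCoalg FAB renaming (I to IAB; θ to θAB)

  ⟦_⟧ : {V : Set} → Tree B V → IAB → Tree A (V × IAB)
  ⟦ leaf v ⟧ σ = leaf (v , σ)
  ⟦ read t ⟧ σ = substT (θAB σ) (λ p → ⟦ t (proj₁ p) ⟧ (proj₂ p))

comp : {A B C : Set} (FAB : FinalCoalg A B) (FBC : FinalCoalg B C) (FAC : FinalCoalg A C) →
       FinalCoalg.I FBC → FinalCoalg.I FAB → FinalCoalg.I FAC
comp FAB FBC FAC τ σ =
  FinalCoalg.unfold FAC
    (λ p → mapT (λ q → proj₁ (proj₁ q) , (proj₂ (proj₁ q) , proj₂ q))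
                (⟦ FAB ⟧ (FinalCoalg.θ FBC (proj₁ p)) (proj₂ p)))
    (τ , σ)

module Submission where

-- Running the lazily composed processor one step on a stream xs consists of
-- running ⟦θ τ⟧ σ, which interleaves the reads of τ with the outputs of σ.
-- Unfolding the definitions, this step produces exactly the first output of τ
-- on reflect σ xs, leaves behind the composite of the residual processors,
-- and the residual of σ applied to what is left of xs reproduces the part of
-- reflect σ xs that τ has not consumed. Induction on the output index then
-- gives the theorem; since streams are functions, "the same stream" means
-- pointwise equality, which reflect and run respect.

open import Defs
open import Data.Nat using (ℕ; zero; suc)
open import Data.Product using (_×_; _,_; proj₁; proj₂; map₂)
open import Relation.Binary.PropositionalEquality
  using (_≡_; _≗_; refl; trans; cong; module ≡-Reasoning)

run-mapT : {X V W : Set} (f : V → W) (t : Tree X V) (xs : Str X) →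
           run (mapT f t) xs ≡ (f (proj₁ (run t xs)) , proj₂ (run t xs))
run-mapT f (leaf v) xs = refl
run-mapT f (read t) xs = run-mapT f (t (xs 0)) (∂ xs)

run-substT : {X V W : Set} (s : Tree X V) (w : V → Tree X W) (xs : Str X) →
             run (substT s w) xs ≡ run (w (proj₁ (run s xs))) (proj₂ (run s xs))
run-substT (leaf v) w xs = refl
run-substT (read t) w xs = run-substT (t (xs 0)) w (∂ xs)

_≋_ : {V X : Set} → V × Str X → V × Str X → Set
p ≋ q = proj₁ p ≡ proj₁ q × proj₂ p ≗ proj₂ q

run-cong : {X V : Set} (t : Tree X V) {xs ys : Str X} → xs ≗ ys → run t xs ≋ run t ys
run-cong (leaf v) xs≗ys = refl , xs≗ys
run-cong (read t) {xs} {ys} xs≗ys rewrite xs≗ys 0 = run-cong (t (ys 0)) (λ n → xs≗ys (suc n))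

module _ {X Y : Set} (F : FinalCoalg X Y) where
  open FinalCoalg F

  reflect-cong : (σ : I) {xs ys : Str X} → xs ≗ ys → reflect F σ xs ≗ reflect F σ ys
  reflect-cong σ xs≗ys zero = cong proj₁ (proj₁ (run-cong (θ σ) xs≗ys))
  reflect-cong σ {xs} {ys} xs≗ys (suc n) = begin
    reflect F (next F σ xs) (tl F σ xs) n ≡⟨ cong (λ σ′ → reflect F σ′ (tl F σ xs) n) next≡ ⟩
    reflect F (next F σ ys) (tl F σ xs) n ≡⟨ reflect-cong (next F σ ys) tl≗ n ⟩
    reflect F (next F σ ys) (tl F σ ys) n ∎
    where
      open ≡-Reasoning
      next≡ : next F σ xs ≡ next F σ ys
      next≡ = cong proj₂ (proj₁ (run-cong (θ σ) xs≗ys))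
      tl≗ : tl F σ xs ≗ tl F σ ys
      tl≗ = proj₂ (run-cong (θ σ) xs≗ys)

module _ {A B : Set} (FAB : FinalCoalg A B) where
  open FinalCoalg FAB

  reflectResidual : {V : Set} → (V × I) × Str A → V × Str B
  reflectResidual ((v , σ) , xs) = v , reflect FAB σ xs

  run-⟦⟧ : {V : Set} (t : Tree B V) (σ : I) (xs : Str A) →
           reflectResidual (run (⟦ FAB ⟧ t σ) xs) ≋ run t (reflect FAB σ xs)
  run-⟦⟧ (leaf v) σ xs = refl , λ n → refl
  run-⟦⟧ (read t) σ xs
    rewrite run-substT (θ σ) (λ p → ⟦ FAB ⟧ (t (proj₁ p)) (proj₂ p)) xs
    = run-⟦⟧ (t (hd FAB σ xs)) (next FAB σ xs) (tl FAB σ xs)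

module _ {A B C : Set} (FAB : FinalCoalg A B) (FBC : FinalCoalg B C) (FAC : FinalCoalg A C) where
  open FinalCoalg

  compStep : I FBC → I FAB → Str A → ((C × I FBC) × I FAB) × Str A
  compStep τ σ xs = run (⟦ FAB ⟧ (θ FBC τ) σ) xs

  reassoc : (C × I FBC) × I FAB → C × (I FBC × I FAB)
  reassoc ((c , τ) , σ) = c , (τ , σ)

  compCoalg : I FBC × I FAB → Tree A (C × (I FBC × I FAB))
  compCoalg (τ , σ) = mapT reassoc (⟦ FAB ⟧ (θ FBC τ) σ)

  run-θ-comp : (τ : I FBC) (σ : I FAB) (xs : Str A) →
               let ((c , τ′) , σ′) , xs′ = compStep τ σ xs in
               run (θ FAC (comp FAB FBC FAC τ σ)) xs ≡ ((c , comp FAB FBC FAC τ′ σ′) , xs′)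
  run-θ-comp τ σ xs = begin
    run (θ FAC (unfold FAC compCoalg (τ , σ))) xs
      ≡⟨ cong (λ t → run t xs) (unfold-hom FAC compCoalg (τ , σ)) ⟩
    run (mapT (map₂ (unfold FAC compCoalg)) (compCoalg (τ , σ))) xs
      ≡⟨ run-mapT (map₂ (unfold FAC compCoalg)) (compCoalg (τ , σ)) xs ⟩
    (map₂ (unfold FAC compCoalg) (proj₁ r) , proj₂ r)
      ≡⟨ cong (λ r′ → map₂ (unfold FAC compCoalg) (proj₁ r′) , proj₂ r′)
              (run-mapT reassoc (⟦ FAB ⟧ (θ FBC τ) σ) xs) ⟩
    _ ∎
    where
      open ≡-Reasoning
      r = run (compCoalg (τ , σ)) xs

  reflect-comp : (τ : I FBC) (σ : I FAB) (xs : Str A) →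
                 reflect FAC (comp FAB FBC FAC τ σ) xs ≗ reflect FBC τ (reflect FAB σ xs)
  reflect-comp τ σ xs n with compStep τ σ xs | run-θ-comp τ σ xs | run-⟦⟧ FAB (θ FBC τ) σ xs
  reflect-comp τ σ xs zero    | _ | run≡ | out≡ , _ = trans (cong (λ p → proj₁ (proj₁ p)) run≡) (cong proj₁ out≡)
  reflect-comp τ σ xs (suc n) | ((c , τ′) , σ′) , xs′ | run≡ | out≡ , rest≗ = begin
    reflect FAC (next FAC (comp FAB FBC FAC τ σ) xs) (tl FAC (comp FAB FBC FAC τ σ) xs) n
      ≡⟨ cong (λ p → reflect FAC (proj₂ (proj₁ p)) (proj₂ p) n) run≡ ⟩
    reflect FAC (comp FAB FBC FAC τ′ σ′) xs′ n
      ≡⟨ reflect-comp τ′ σ′ xs′ n ⟩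
    reflect FBC τ′ (reflect FAB σ′ xs′) n
      ≡⟨ cong (λ τ″ → reflect FBC τ″ (reflect FAB σ′ xs′) n) (cong proj₂ out≡) ⟩
    reflect FBC (next FBC τ ys) (reflect FAB σ′ xs′) n
      ≡⟨ reflect-cong FBC (next FBC τ ys) rest≗ n ⟩
    reflect FBC (next FBC τ ys) (tl FBC τ ys) n ∎
    where
      open ≡-Reasoning
      ys = reflect FAB σ xs

proposition4p7 : {A B C : Set} (FAB : FinalCoalg A B) (FBC : FinalCoalg B C) (FAC : FinalCoalg A C) →
                 (τ : FinalCoalg.I FBC) (σ : FinalCoalg.I FAB) (xs : Str A) (n : ℕ) →
                 reflect FAC (comp FAB FBC FAC τ σ) xs n ≡ reflect FBC τ (reflect FAB σ xs) n
proposition4p7 FAB FBC FAC = reflect-comp FAB FBC FAC
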